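{- Let $\mathcal{F}$ be a finite union-closed family of sets with $\emptyset\notin\mathcal{F}$ and height number $H(\mathcal{F})\ge2$. Let $A,B\in\mathcal{F}$ with $A\neq B$ lie in the same $k$-th height of $\mathcal{F}$, where $k\neq H(\mathcal{F})$. For $X\in\{A,B\}$ let $T(X)$ consist of $X$ together with all sets of the $(k+1)$-th height of $\mathcal{F}$ contained in $X$. Then the number of sets of the $(k+1)$-th height belonging to both $T(A)$ and $T(B)$ is at most $1$; equivalently $|T(A)\cap T(B)|\le1$.
   Context: A union-closed family is a finite family $\mathcal{F}$ of finite sets closed under pairwise union. Height decomposition: $\pi_1$ is the set of inclusion-minimal members of $\mathcal{F}$; inductively, while $\mathcal{F}\setminus(\pi_1\cup\dots\cup\pi_{i-1})\neq\emptyset$, $\pi_i$ is the set of inclusion-minimal members of $\mathcal{F}\setminus(\pi_1\cup\dots\cup\pi_{i-1})$; the number of steps until $\mathcal{F}$ is exhausted is the height number $H(\mathcal{F})$. For $1\le j\le H(\mathcal{F})$, the $j$-th height of $\mathcal{F}$ is $\pi_{H(\mathcal{F})+1-j}$. -}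

module Defs where

open import Data.Nat using (ℕ; zero; suc; _+_; _∸_)
open import Data.Bool using (Bool)
open import Data.Fin.Subset using (Subset; _∪_; _⊂_)
open import Data.Fin.Subset.Properties using (_⊂?_)
open import Data.List using (List; []; _∷_; filter; length)
open import Data.List.Membership.Propositional using (_∈_)
open import Data.List.Membership.DecPropositional using () renaming (_∈?_ to ∈?-gen)
open import Data.List.Relation.Unary.Any using (any?)
open import Data.Vec.Properties using (≡-dec)
import Data.Bool.Properties as BP
open import Relation.Nullary using (¬_)
open import Relation.Nullary.Decidable using (¬?)
open import Relation.Binary.PropositionalEquality using (_≡_)

-- A finite family of (finite) sets: subsets of a finite ground set Fin n,
-- given as a list (duplicates are harmless: membership is what matters).
Family : ℕ → Set
Family n = List (Subset n)

UnionClosed : ∀ {n} → Family n → Set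
UnionClosed F = ∀ {X Y} → X ∈ F → Y ∈ F → (X ∪ Y) ∈ F

minimals : ∀ {n} → List (Subset n) → List (Subset n)
minimals L = filter (λ X → ¬? (any? (λ Y → Y ⊂? X) L)) L

removeAll : ∀ {n} → List (Subset n) → List (Subset n) → List (Subset n)
removeAll {n} M L = filter (λ X → ¬? (∈?-gen (≡-dec BP._≟_) X M)) L

-- Iterated decomposition with fuel: π₁ , π₂ , ... (bottom-up), stopping
-- when the remaining family is empty.
layersFuel : ∀ {n} → ℕ → List (Subset n) → List (List (Subset n))
layersFuel zero    L        = []
layersFuel (suc f) []       = []
layersFuel (suc f) (X ∷ L)  =
  minimals (X ∷ L) ∷ layersFuel f (removeAll (minimals (X ∷ L)) (X ∷ L))

-- Each step removes at least one member, so |F| steps suffice.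
layers : ∀ {n} → Family n → List (List (Subset n))
layers F = layersFuel (length F) F

heightNumber : ∀ {n} → Family n → ℕ
heightNumber F = length (layers F)

-- i-th element of a list of layers (1-based), [] if out of range.
nthLayer : ∀ {n} → ℕ → List (List (Subset n)) → List (Subset n)
nthLayer _             []       = []
nthLayer zero          (_ ∷ _)  = []
nthLayer (suc zero)    (π ∷ _)  = π
nthLayer (suc (suc i)) (_ ∷ πs) = nthLayer (suc i) πs

piLayer : ∀ {n} → Family n → ℕ → List (Subset n)
piLayer F i = nthLayer i (layers F)

height : ∀ {n} → Family n → ℕ → List (Subset n)
height F j = piLayer F (heightNumber F + 1 ∸ j)

-- If C ≠ D are common lower covers of A ≠ B taken from the layer just below,
-- then C ∪ D is a member of F strictly above C, so it is not removed together
-- with C's layer; being below A and B, which are minimal among what remains,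
-- it equals both A and B, contradicting A ≠ B.
module Submission where

open import Defs
open import Data.Nat using (ℕ; zero; suc; _≤_; _<_; _+_; _∸_; s≤s)
open import Data.Nat.Properties using (+-comm)
open import Data.Fin.Subset using (Subset; _⊆_; _⊂_; _∪_; ⊥; inside; outside)
open import Data.Fin.Subset.Properties using (p⊆p∪q; q⊆p∪q; x∈p∪q⁻; out⊂; out⊂in; s⊂s; drop-∷-⊆)
open import Data.Vec using (_∷_; []; here)
open import Data.Vec.Properties using (≡-dec)
open import Data.Bool.Properties using () renaming (_≟_ to _≟ᵇ_)
open import Data.List using (List; _∷_; []; length)
open import Data.List.Membership.Propositional using (_∈_; _∉_; lose)
open import Data.List.Membership.Propositional.Properties using (∈-filter⁺; ∈-filter⁻)
open import Data.Product using (Σ-syntax; _×_; _,_; proj₁; proj₂)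
open import Data.Sum using (inj₁; inj₂)
open import Function using (_∘_)
open import Relation.Nullary using (Dec; yes; no; ¬_; contradiction)
open import Relation.Binary.PropositionalEquality
  using (_≡_; _≢_; refl; sym; trans; cong; subst)

infix 4 _≟_
_≟_ : ∀ {n} → (p q : Subset n) → Dec (p ≡ q)
_≟_ = ≡-dec _≟ᵇ_

⊆∧≢⇒⊂ : ∀ {n} {p q : Subset n} → p ⊆ q → p ≢ q → p ⊂ q
⊆∧≢⇒⊂ {p = []}          {[]}          _   p≢q = contradiction refl p≢q
⊆∧≢⇒⊂ {p = outside ∷ p} {outside ∷ q} p⊆q p≢q = out⊂ (⊆∧≢⇒⊂ (drop-∷-⊆ p⊆q) (p≢q ∘ cong (outside ∷_)))
⊆∧≢⇒⊂ {p = outside ∷ p} {inside  ∷ q} p⊆q _   = out⊂in (drop-∷-⊆ p⊆q)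
⊆∧≢⇒⊂ {p = inside  ∷ p} {outside ∷ q} p⊆q _   with () ← p⊆q here
⊆∧≢⇒⊂ {p = inside  ∷ p} {inside  ∷ q} p⊆q p≢q = s⊂s (⊆∧≢⇒⊂ (drop-∷-⊆ p⊆q) (p≢q ∘ cong (inside ∷_)))

∪-least : ∀ {n} {p q r : Subset n} → p ⊆ r → q ⊆ r → p ∪ q ⊆ r
∪-least {p = p} {q} p⊆r q⊆r x∈p∪q with x∈p∪q⁻ p q x∈p∪q
... | inj₁ x∈p = p⊆r x∈p
... | inj₂ x∈q = q⊆r x∈q

module _ {n : ℕ} where

  ∈-minimals⁻ : ∀ {X : Subset n} {L} → X ∈ minimals L → X ∈ L
  ∈-minimals⁻ {L = L} X∈min = proj₁ (∈-filter⁻ _ {xs = L} X∈min)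

  minimals-minimal : ∀ {X Y : Subset n} {L} → X ∈ minimals L → Y ∈ L → ¬ Y ⊂ X
  minimals-minimal {L = L} X∈min Y∈L Y⊂X = proj₂ (∈-filter⁻ _ {xs = L} X∈min) (lose Y∈L Y⊂X)

  minimals-antichain : ∀ {X Y : Subset n} {L} → X ∈ minimals L → Y ∈ minimals L → X ⊆ Y → X ≡ Y
  minimals-antichain {X} {Y} {L} X∈min Y∈min X⊆Y with X ≟ Y
  ... | yes X≡Y = X≡Y
  ... | no  X≢Y = contradiction (⊆∧≢⇒⊂ X⊆Y X≢Y) (minimals-minimal Y∈min (∈-minimals⁻ {L = L} X∈min))

  ∈-removeAll⁻ : ∀ {X : Subset n} {M L} → X ∈ removeAll M L → X ∈ L
  ∈-removeAll⁻ {L = L} X∈rem = proj₁ (∈-filter⁻ _ {xs = L} X∈rem)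

  ∈-removeAll-minimals⁺ : ∀ {X Y : Subset n} {L} → X ∈ L → Y ∈ L → Y ⊂ X →
                          X ∈ removeAll (minimals L) L
  ∈-removeAll-minimals⁺ X∈L Y∈L Y⊂X = ∈-filter⁺ _ X∈L (λ X∈min → minimals-minimal X∈min Y∈L Y⊂X)

-- residual j F is F ∖ (π₁ ∪ ⋯ ∪ π_j), so that π_{j+1} = minimals (residual j F).
residual : ∀ {n} → ℕ → List (Subset n) → List (Subset n)
residual zero    L = L
residual (suc j) L = residual j (removeAll (minimals L) L)

module _ {n : ℕ} where

  ∈-residual⁻ : ∀ j {X : Subset n} {L} → X ∈ residual j L → X ∈ L
  ∈-residual⁻ zero    X∈res = X∈res
  ∈-residual⁻ (suc j) X∈res = ∈-removeAll⁻ (∈-residual⁻ j X∈res)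

  ∈-nthLayer⇒∈-minimals-residual : ∀ f j {X : Subset n} {L} →
    X ∈ nthLayer (suc j) (layersFuel f L) → X ∈ minimals (residual j L)
  ∈-nthLayer⇒∈-minimals-residual (suc f) zero    {L = _ ∷ _} X∈π = X∈π
  ∈-nthLayer⇒∈-minimals-residual (suc f) (suc j) {L = _ ∷ _} X∈π =
    ∈-nthLayer⇒∈-minimals-residual f j X∈π

  ∈-piLayer⇒∈-minimals-residual : ∀ (F : Family n) j {X} →
    X ∈ piLayer F (suc j) → X ∈ minimals (residual j F)
  ∈-piLayer⇒∈-minimals-residual F j = ∈-nthLayer⇒∈-minimals-residual (length F) j

  ⊃-minimals-residual⇒∈-residual : ∀ j {C X : Subset n} {L} →
    X ∈ L → C ∈ minimals (residual j L) → C ⊂ X → X ∈ residual (suc j) L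
  ⊃-minimals-residual⇒∈-residual zero    X∈L C∈π C⊂X =
    ∈-removeAll-minimals⁺ X∈L (∈-minimals⁻ C∈π) C⊂X
  ⊃-minimals-residual⇒∈-residual (suc j) X∈L C∈π C⊂X =
    ⊃-minimals-residual⇒∈-residual j
      (∈-removeAll-minimals⁺ X∈L (∈-residual⁻ (suc j) (∈-minimals⁻ C∈π)) C⊂X) C∈π C⊂X

  between-consecutive-layers⇒≡ : ∀ j {C X A : Subset n} {L} →
    X ∈ L → C ∈ minimals (residual j L) → A ∈ minimals (residual (suc j) L) →
    C ⊂ X → X ⊆ A → X ≡ A
  between-consecutive-layers⇒≡ j {X = X} {A} X∈L C∈π A∈π C⊂X X⊆A with X ≟ A
  ... | yes X≡A = X≡A
  ... | no  X≢A = contradiction (⊆∧≢⇒⊂ X⊆A X≢A)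
        (minimals-minimal A∈π (⊃-minimals-residual⇒∈-residual j X∈L C∈π C⊂X))

  common-lower-cover-unique : ∀ {L : List (Subset n)} → UnionClosed L → ∀ j {A B C D} →
    A ∈ minimals (residual (suc j) L) → B ∈ minimals (residual (suc j) L) → A ≢ B →
    C ∈ minimals (residual j L) → C ⊆ A → C ⊆ B →
    D ∈ minimals (residual j L) → D ⊆ A → D ⊆ B →
    C ≡ D
  common-lower-cover-unique {L} uc j {A} {B} {C} {D} A∈π B∈π A≢B C∈π C⊆A C⊆B D∈π D⊆A D⊆B
    with C ∪ D ≟ C
  ... | yes C∪D≡C = sym (minimals-antichain {L = residual j L} D∈π C∈π (subst (D ⊆_) C∪D≡C (q⊆p∪q C D)))
  ... | no  C∪D≢C = contradiction (trans (sym (C∪D≡ A∈π (∪-least C⊆A D⊆A)))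
                                          (C∪D≡ B∈π (∪-least C⊆B D⊆B))) A≢B
    where
    C∪D∈L : C ∪ D ∈ L
    C∪D∈L = uc (∈-residual⁻ j (∈-minimals⁻ {L = residual j L} C∈π))
               (∈-residual⁻ j (∈-minimals⁻ {L = residual j L} D∈π))

    C∪D≡ : ∀ {X} → X ∈ minimals (residual (suc j) L) → C ∪ D ⊆ X → C ∪ D ≡ X
    C∪D≡ X∈π C∪D⊆X = between-consecutive-layers⇒≡ j C∪D∈L C∈π X∈π
      (⊆∧≢⇒⊂ (p⊆p∪q D) (C∪D≢C ∘ sym)) C∪D⊆X

-- Heights k and k + 1 are the layers π_{j+2} and π_{j+1}, with j = H − k − 1.
consecutive-layer-indices : ∀ H k → k < H →
  Σ[ j ∈ ℕ ] (H + 1 ∸ k ≡ suc (suc j)) × (H + 1 ∸ suc k ≡ suc j)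
consecutive-layer-indices (suc H) zero    _         = H , cong suc (+-comm H 1) , +-comm H 1
consecutive-layer-indices (suc H) (suc k) (s≤s k<H) = consecutive-layer-indices H k k<H

lemma3p2p2 : ∀ {n} (F : Family n) → UnionClosed F → ⊥ ∉ F →
    2 ≤ heightNumber F →
    ∀ (k : ℕ) → 1 ≤ k → k < heightNumber F →
    ∀ (A B : Subset n) → A ≢ B → A ∈ height F k → B ∈ height F k →
    ∀ (C D : Subset n) →
    C ∈ height F (suc k) → C ⊆ A → C ⊆ B →
    D ∈ height F (suc k) → D ⊆ A → D ⊆ B →
    C ≡ D
lemma3p2p2 F uc _ _ k _ k<H A B A≢B A∈hₖ B∈hₖ C D C∈hₖ₊₁ C⊆A C⊆B D∈hₖ₊₁ D⊆A D⊆B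
  with j , eₖ , eₖ₊₁ ← consecutive-layer-indices (heightNumber F) k k<H
  rewrite eₖ | eₖ₊₁
  = common-lower-cover-unique uc j
      (layer (suc j) A∈hₖ) (layer (suc j) B∈hₖ) A≢B
      (layer j C∈hₖ₊₁) C⊆A C⊆B
      (layer j D∈hₖ₊₁) D⊆A D⊆B
  where
  layer : ∀ i {X} → X ∈ piLayer F (suc i) → X ∈ minimals (residual i F)
  layer = ∈-piLayer⇒∈-minimals-residual F
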